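{- Let $G$ be a finite, simple, undirected, connected graph that contains no triangle $K_3$ and has no pair of false-twin vertices. Suppose that $v$ is a vertex of $G$ such that the graph $G-\{v\}$ has exactly $k$ (maximal) sets of false-twin vertices. Then the number of bicliques of $G-\{v\}$ is at least $k$ less than the number of bicliques of $G$.
   Context: All graphs are finite, simple and undirected; $G$ is connected (standing assumption of the paper). A biclique of a graph is a maximal (with respect to vertex-set inclusion) induced subgraph that is a complete bipartite graph $K_{p,q}$ with $p,q\geq 1$; bicliques are counted as distinct vertex sets. Two distinct vertices $u,w$ are false-twins if $N(u)=N(w)$, where $N(\cdot)$ denotes the open neighborhood; a set of false-twin vertices is a maximal set, of size at least two, of pairwise false-twin vertices. -}

module Defs where

open import Data.Nat using (ℕ; suc)
open import Data.Fin using (Fin; punchIn)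
open import Data.Fin.Subset using (Subset; _∈_; _∉_; _⊆_)
open import Data.Bool using (Bool; true)
open import Data.Product using (Σ; ∃; _×_; _,_)
open import Data.Sum using (_⊎_)
open import Data.List using (List)
import Data.List.Membership.Propositional as LM
open import Data.List.Relation.Unary.Unique.Propositional using (Unique)
open import Relation.Binary.PropositionalEquality using (_≡_; _≢_)
open import Relation.Nullary using (¬_)
open import Function.Bundles using (_⇔_)

record Graph (n : ℕ) : Set where
  field
    adj   : Fin n → Fin n → Bool
    sym   : ∀ i j → adj i j ≡ adj j i
    irrefl : ∀ i → ¬ (adj i i ≡ true)

module _ {n : ℕ} (G : Graph n) where
  open Graph G

  Adj : Fin n → Fin n → Set
  Adj i j = adj i j ≡ true

  data Reach : Fin n → Fin n → Set where
    here : ∀ {i} → Reach i i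
    step : ∀ {i j k} → Adj i j → Reach j k → Reach i k

  Connected : Set
  Connected = ∀ i j → Reach i j

  TriangleFree : Set
  TriangleFree = ∀ a b c → ¬ (Adj a b × Adj b c × Adj a c)

  FalseTwins : Fin n → Fin n → Set
  FalseTwins u w = u ≢ w × (∀ x → (Adj u x ⇔ Adj w x))

  NoFalseTwins : Set
  NoFalseTwins = ∀ u w → ¬ FalseTwins u w

  PairwiseFalseTwins : Subset n → Set
  PairwiseFalseTwins S = ∀ u w → u ∈ S → w ∈ S → u ≢ w → FalseTwins u w

  -- a (maximal) set of false-twin vertices: a maximal set of size ≥ 2
  -- of pairwise false-twin vertices
  IsFalseTwinSet : Subset n → Set
  IsFalseTwinSet S =
    (Σ (Fin n) λ u → Σ (Fin n) λ w → u ∈ S × w ∈ S × u ≢ w)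
    × PairwiseFalseTwins S
    × (∀ T → S ⊆ T → PairwiseFalseTwins T → T ≡ S)

  IsCompleteBipartite : Subset n → Set
  IsCompleteBipartite S =
    Σ (Subset n) λ X → Σ (Subset n) λ Y →
      (∃ λ x → x ∈ X) × (∃ λ y → y ∈ Y)
      × (∀ z → (z ∈ S ⇔ (z ∈ X ⊎ z ∈ Y)))
      × (∀ z → z ∈ X → z ∉ Y)
      × (∀ a b → a ∈ X → b ∈ X → ¬ Adj a b)
      × (∀ a b → a ∈ Y → b ∈ Y → ¬ Adj a b)
      × (∀ a b → a ∈ X → b ∈ Y → Adj a b)

  IsBiclique : Subset n → Set
  IsBiclique S = IsCompleteBipartite S × (∀ T → S ⊆ T → IsCompleteBipartite T → T ≡ S)

deleteVertex : {m : ℕ} → Graph (suc m) → Fin (suc m) → Graph m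
deleteVertex G v = record
  { adj = λ i j → Graph.adj G (punchIn v i) (punchIn v j)
  ; sym = λ i j → Graph.sym G (punchIn v i) (punchIn v j)
  ; irrefl = λ i → Graph.irrefl G (punchIn v i)
  }

-- L is a duplicate-free list of exactly the subsets satisfying P;
-- its length is then the number of such subsets.
Enumerates : {n : ℕ} → (Subset n → Set) → List (Subset n) → Set
Enumerates P L = Unique L × (∀ S → (S LM.∈ L ⇔ P S))

-- The bound comes from two injections into the bicliques of G with disjoint
-- images, one from the bicliques and one from the false-twin sets of G − v.
-- A biclique S of G − v is lifted to S ∪ {v} when every edge of S has an
-- endpoint adjacent to v, and to S otherwise; by triangle-freeness, v is then
-- adjacent to all of one side of S. A false-twin set F of G − v contains a
-- vertex s₁ adjacent to v and a vertex s₂ that is not, because G has no false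
-- twins; F is sent to the biclique of G with one side N_G(s₁) (the other side
-- being the common neighbours of N_G(s₁)). This biclique determines N_G(s₁),
-- as the vertices of it not adjacent to v, hence determines F. It is never a
-- lifted biclique: its trace on G − v is not maximal, since s₂ (which has a
-- neighbour, G being connected) sees exactly N_G(s₁) − v and can join the side
-- of s₁.

module Submission where

open import Defs
open import Data.Nat using (ℕ; suc; _+_; _≤_)
open import Data.Fin using (Fin)
open import Data.Fin.Subset using (Subset)
open import Data.List using (List; length)
open import Relation.Binary.PropositionalEquality using (_≡_)

open import Data.Bool using (true; false)
import Data.Bool as Bool
open import Data.Bool.Properties using (T-≡)
open import Data.Empty using (⊥; ⊥-elim)
open import Data.Fin using (zero; suc; punchIn; punchOut)
open import Data.Fin.Properties using (all?; any?; injective⇒≤; punchIn-punchOut; punchIn-injective; punchInᵢ≢i)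
  renaming (_≟_ to _≟ᶠ_)
open import Data.Fin.Subset using (_∈_; _∉_; _⊆_; _∪_; ⁅_⁆)
open import Data.Fin.Subset.Properties using (_∈?_; x∈p∪q⁻; x∈p∪q⁺; x∈⁅x⁆; x∈⁅y⁆⇒x≡y; ⊆-antisym; p⊆p∪q; q⊆p∪q)
import Data.List as List
open import Data.List using (map; _++_)
open import Data.List.Membership.Propositional using () renaming (_∈_ to _∈ₗ_)
open import Data.List.Membership.Propositional.Properties using (∈-lookup; ∈-map⁻; ∈-++⁻)
open import Data.List.Properties using (length-++; length-map)
import Data.List.Relation.Unary.All as All
open import Data.List.Relation.Unary.Any using (index)
open import Data.List.Relation.Unary.Any.Properties using (lookup-index)
open import Data.List.Relation.Unary.AllPairs using (_∷_)
open import Data.List.Relation.Unary.Unique.Propositional using (Unique)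
import Data.List.Relation.Unary.Unique.Propositional.Properties as Unique
open import Data.Product using (∃; ∃-syntax; _×_; _,_; proj₁; proj₂)
import Data.Product
open import Data.Sum using (_⊎_; inj₁; inj₂; [_,_])
import Data.Sum as Sum
open import Data.Sum.Properties using (inj₁-injective; inj₂-injective)
open import Data.Vec using (tabulate; insertAt)
open import Data.Vec.Properties using (lookup∘tabulate; []=⇒lookup; lookup⇒[]=; insertAt-lookup; insertAt-punchIn)
open import Function using (_∘_; case_of_)
open import Function.Construct.Composition using (_⇔-∘_)
open import Function.Construct.Identity using (⇔-id)
open import Function.Construct.Symmetry using (⇔-sym)
open import Function.Bundles using (_⇔_; mk⇔; Equivalence)
open import Relation.Binary.PropositionalEquality using (_≢_; refl; sym; trans; cong; cong₂; subst; module ≡-Reasoning)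
open import Relation.Nullary using (¬_; Dec; yes; no; contradiction)
open import Relation.Nullary.Decidable using (isYes; toWitness; fromWitness; _×-dec_; _⊎-dec_; _→-dec_)
open import Relation.Unary using (Decidable)

open Equivalence using (to; from)

isYes≡true⇔ : {A : Set} (d : Dec A) → isYes d ≡ true ⇔ A
isYes≡true⇔ d = mk⇔ (toWitness ∘ from T-≡) (to T-≡ ∘ fromWitness)

select : {n : ℕ} {P : Fin n → Set} → Decidable P → Subset n
select P? = tabulate (isYes ∘ P?)

∈-select : {n : ℕ} {P : Fin n → Set} (P? : Decidable P) {x : Fin n} → x ∈ select P? ⇔ P x
∈-select P? {x} = isYes≡true⇔ (P? x) ⇔-∘ mk⇔
  (trans (sym (lookup∘tabulate _ x)) ∘ []=⇒lookup)
  (lookup⇒[]= x _ ∘ trans (lookup∘tabulate _ x))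

∈-∪⁅⁆ : ∀ {n} {p : Subset n} {w z : Fin n} → z ∈ p ∪ ⁅ w ⁆ ⇔ (z ∈ p ⊎ z ≡ w)
∈-∪⁅⁆ {p = p} {w} = mk⇔ (Sum.map₂ (x∈⁅y⁆⇒x≡y w) ∘ x∈p∪q⁻ p ⁅ w ⁆) (x∈p∪q⁺ ∘ Sum.map₂ λ { refl → x∈⁅x⁆ w })

-- Counting by injections

module _ {A : Set} where

  lookup-injective : {xs : List A} → Unique xs → ∀ i j → List.lookup xs i ≡ List.lookup xs j → i ≡ j
  lookup-injective (_ ∷ _) zero zero _ = refl
  lookup-injective (x∉ ∷ _) zero (suc j) eq = contradiction eq (All.lookup x∉ (∈-lookup j))
  lookup-injective (x∉ ∷ _) (suc i) zero eq = contradiction (sym eq) (All.lookup x∉ (∈-lookup i))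
  lookup-injective (_ ∷ u) (suc i) (suc j) eq = cong suc (lookup-injective u i j eq)

  length-≤-injection : {C : Set} (f : A → C) {xs : List A} {zs : List C} → Unique xs
    → (∀ {x} → x ∈ₗ xs → f x ∈ₗ zs)
    → (∀ {x y} → x ∈ₗ xs → y ∈ₗ xs → f x ≡ f y → x ≡ y)
    → length xs ≤ length zs
  length-≤-injection f {xs} {zs} unique into injective = injective⇒≤ h-injective
    where
      h : Fin (length xs) → Fin (length zs)
      h i = index (into (∈-lookup i))
      h-injective : ∀ {i j} → h i ≡ h j → i ≡ j
      h-injective {i} {j} hi≡hj = lookup-injective unique i j (injective (∈-lookup i) (∈-lookup j) (begin
        f (List.lookup xs i)  ≡⟨ lookup-index (into (∈-lookup i)) ⟩
        List.lookup zs (h i)  ≡⟨ cong (List.lookup zs) hi≡hj ⟩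
        List.lookup zs (h j)  ≡⟨ sym (lookup-index (into (∈-lookup j))) ⟩
        f (List.lookup xs j)  ∎))
        where open ≡-Reasoning

module _ {a b c : ℕ} {P : Subset a → Set} {Q : Subset b → Set} {R : Subset c → Set}
         {xs : List (Subset a)} {ys : List (Subset b)} {zs : List (Subset c)}
         (P-enum : Enumerates P xs) (Q-enum : Enumerates Q ys) (R-enum : Enumerates R zs)
         (f : Subset a → Subset c) (g : Subset b → Subset c) where

  private
    ws : List (Subset a ⊎ Subset b)
    ws = map inj₁ xs ++ map inj₂ ys

    data Source : Subset a ⊎ Subset b → Set where
      left  : ∀ {S} → P S → Source (inj₁ S)
      right : ∀ {F} → Q F → Source (inj₂ F)

    source : ∀ {w} → w ∈ₗ ws → Source w
    source w∈ with ∈-++⁻ (map inj₁ xs) w∈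
    ... | inj₁ w∈xs with ∈-map⁻ inj₁ w∈xs
    ...   | S , S∈ , refl = left (to (proj₂ P-enum S) S∈)
    source w∈ | inj₂ w∈ys with ∈-map⁻ inj₂ w∈ys
    ...   | F , F∈ , refl = right (to (proj₂ Q-enum F) F∈)

    ws-unique : Unique ws
    ws-unique =
      Unique.++⁺ (Unique.map⁺ inj₁-injective (proj₁ P-enum)) (Unique.map⁺ inj₂-injective (proj₁ Q-enum))
        λ (w∈xs , w∈ys) → disjoint (∈-map⁻ inj₁ w∈xs) (∈-map⁻ inj₂ w∈ys)
      where
        disjoint : ∀ {w} → ∃[ S ] S ∈ₗ xs × w ≡ inj₁ S → ∃[ F ] F ∈ₗ ys × w ≡ inj₂ F → ⊥
        disjoint (_ , _ , refl) (_ , _ , ())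

  enumeration-count :
      (∀ {S} → P S → R (f S)) → (∀ {F} → Q F → R (g F))
    → (∀ {S S'} → P S → P S' → f S ≡ f S' → S ≡ S')
    → (∀ {F F'} → Q F → Q F' → g F ≡ g F' → F ≡ F')
    → (∀ {S F} → P S → Q F → f S ≢ g F)
    → length xs + length ys ≤ length zs
  enumeration-count f-into g-into f-injective g-injective f≢g =
    subst (_≤ length zs) length-ws (length-≤-injection [ f , g ] ws-unique into injective)
    where
      length-ws : length ws ≡ length xs + length ys
      length-ws = trans (length-++ (map inj₁ xs)) (cong₂ _+_ (length-map inj₁ xs) (length-map inj₂ ys))
      into : ∀ {w} → w ∈ₗ ws → [ f , g ] w ∈ₗ zs
      into w∈ with source w∈
      ... | left PS = from (proj₂ R-enum _) (f-into PS)
      ... | right QF = from (proj₂ R-enum _) (g-into QF)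
      injective : ∀ {w w'} → w ∈ₗ ws → w' ∈ₗ ws → [ f , g ] w ≡ [ f , g ] w' → w ≡ w'
      injective w∈ w'∈ eq with source w∈ | source w'∈
      ... | left PS  | left PS'  = cong inj₁ (f-injective PS PS' eq)
      ... | right QF | right QF' = cong inj₂ (g-injective QF QF' eq)
      ... | left PS  | right QF  = contradiction eq (f≢g PS QF)
      ... | right QF | left PS   = contradiction (sym eq) (f≢g PS QF)

-- Complete bipartite subgraphs and bicliques

module _ {n : ℕ} (K : Graph n) where

  Adj-sym : ∀ {a b} → Adj K a b → Adj K b a
  Adj-sym {a} {b} = trans (Graph.sym K b a)

  Adj? : ∀ a b → Dec (Adj K a b)
  Adj? a b = Graph.adj K a b Bool.≟ true

  record Bipartition (S : Subset n) : Set where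
    field
      X Y           : Subset n
      X-nonempty    : ∃ (_∈ X)
      Y-nonempty    : ∃ (_∈ Y)
      ∈-parts       : ∀ z → z ∈ S ⇔ (z ∈ X ⊎ z ∈ Y)
      X∩Y-empty     : ∀ z → z ∈ X → z ∉ Y
      X-independent : ∀ a b → a ∈ X → b ∈ X → ¬ Adj K a b
      Y-independent : ∀ a b → a ∈ Y → b ∈ Y → ¬ Adj K a b
      complete      : ∀ a b → a ∈ X → b ∈ Y → Adj K a b

    x₀ : Fin n
    x₀ = proj₁ X-nonempty

    x₀∈X : x₀ ∈ X
    x₀∈X = proj₂ X-nonempty

    y₀ : Fin n
    y₀ = proj₁ Y-nonempty

    y₀∈Y : y₀ ∈ Y
    y₀∈Y = proj₂ Y-nonempty

    X⊆S : X ⊆ S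
    X⊆S = from (∈-parts _) ∘ inj₁

    Y⊆S : Y ⊆ S
    Y⊆S = from (∈-parts _) ∘ inj₂

  toBipartition : ∀ {S} → IsCompleteBipartite K S → Bipartition S
  toBipartition (X , Y , X≠∅ , Y≠∅ , ∈-parts , X∩Y , X-ind , Y-ind , complete) =
    record { X = X ; Y = Y ; X-nonempty = X≠∅ ; Y-nonempty = Y≠∅ ; ∈-parts = ∈-parts ; X∩Y-empty = X∩Y
           ; X-independent = X-ind ; Y-independent = Y-ind ; complete = complete }

  fromBipartition : ∀ {S} → Bipartition S → IsCompleteBipartite K S
  fromBipartition B =
    X , Y , X-nonempty , Y-nonempty , ∈-parts , X∩Y-empty , X-independent , Y-independent , complete
    where open Bipartition B

  swap : ∀ {S} → Bipartition S → Bipartition S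
  swap B = record
    { X = Y ; Y = X ; X-nonempty = Y-nonempty ; Y-nonempty = X-nonempty
    ; ∈-parts = λ z → mk⇔ (Sum.swap ∘ to (∈-parts z)) (from (∈-parts z) ∘ Sum.swap)
    ; X∩Y-empty = λ z z∈Y z∈X → X∩Y-empty z z∈X z∈Y
    ; X-independent = Y-independent ; Y-independent = X-independent
    ; complete = λ a b a∈Y b∈X → Adj-sym (complete b a b∈X a∈Y)
    }
    where open Bipartition B

  Bipartition-resp : ∀ {S T} → (∀ z → z ∈ S ⇔ z ∈ T) → Bipartition S → Bipartition T
  Bipartition-resp S≐T B = record
    { X = X ; Y = Y ; X-nonempty = X-nonempty ; Y-nonempty = Y-nonempty
    ; ∈-parts = λ z → mk⇔ (to (∈-parts z) ∘ from (S≐T z)) (to (S≐T z) ∘ from (∈-parts z))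
    ; X∩Y-empty = X∩Y-empty ; X-independent = X-independent ; Y-independent = Y-independent
    ; complete = complete
    }
    where open Bipartition B

  edge-crosses : ∀ {S} (B : Bipartition S) → let open Bipartition B in
    ∀ {a b} → a ∈ S → b ∈ S → Adj K a b → (a ∈ X × b ∈ Y) ⊎ (a ∈ Y × b ∈ X)
  edge-crosses B {a} {b} a∈S b∈S ab = cross (to (∈-parts a) a∈S) (to (∈-parts b) b∈S)
    where
      open Bipartition B
      cross : a ∈ X ⊎ a ∈ Y → b ∈ X ⊎ b ∈ Y → (a ∈ X × b ∈ Y) ⊎ (a ∈ Y × b ∈ X)
      cross (inj₁ a∈X) (inj₁ b∈X) = ⊥-elim (X-independent a b a∈X b∈X ab)
      cross (inj₁ a∈X) (inj₂ b∈Y) = inj₁ (a∈X , b∈Y)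
      cross (inj₂ a∈Y) (inj₁ b∈X) = inj₂ (a∈Y , b∈X)
      cross (inj₂ a∈Y) (inj₂ b∈Y) = ⊥-elim (Y-independent a b a∈Y b∈Y ab)

  Bipartition-∪-⁅⁆ : ∀ {S w} (B : Bipartition S) → let open Bipartition B in
    (∀ y → y ∈ Y → Adj K w y) → (∀ x → x ∈ X → ¬ Adj K w x) → Bipartition (S ∪ ⁅ w ⁆)
  Bipartition-∪-⁅⁆ {S} {w} B w~Y w≁X = record
    { X = X ∪ ⁅ w ⁆ ; Y = Y
    ; X-nonempty = w , from ∈-∪⁅⁆ (inj₂ refl)
    ; Y-nonempty = Y-nonempty
    ; ∈-parts = λ z → mk⇔ (parts⁺ ∘ to ∈-∪⁅⁆) (from ∈-∪⁅⁆ ∘ parts⁻)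
    ; X∩Y-empty = λ z z∈X' z∈Y → disjoint (to ∈-∪⁅⁆ z∈X') z∈Y
    ; X-independent = λ a b a∈X' b∈X' → independent (to ∈-∪⁅⁆ a∈X') (to ∈-∪⁅⁆ b∈X')
    ; Y-independent = Y-independent
    ; complete = λ a b a∈X' b∈Y → complete′ (to ∈-∪⁅⁆ a∈X') b∈Y
    }
    where
      open Bipartition B
      parts⁺ : ∀ {z} → z ∈ S ⊎ z ≡ w → z ∈ X ∪ ⁅ w ⁆ ⊎ z ∈ Y
      parts⁺ (inj₁ z∈S) = Sum.map₁ (from ∈-∪⁅⁆ ∘ inj₁) (to (∈-parts _) z∈S)
      parts⁺ (inj₂ z≡w) = inj₁ (from ∈-∪⁅⁆ (inj₂ z≡w))
      parts⁻ : ∀ {z} → z ∈ X ∪ ⁅ w ⁆ ⊎ z ∈ Y → z ∈ S ⊎ z ≡ w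
      parts⁻ (inj₁ z∈X') = Sum.map₁ (from (∈-parts _) ∘ inj₁) (to ∈-∪⁅⁆ z∈X')
      parts⁻ (inj₂ z∈Y) = inj₁ (from (∈-parts _) (inj₂ z∈Y))
      disjoint : ∀ {z} → z ∈ X ⊎ z ≡ w → z ∉ Y
      disjoint (inj₁ z∈X) = X∩Y-empty _ z∈X
      disjoint (inj₂ refl) w∈Y = Graph.irrefl K w (w~Y w w∈Y)
      independent : ∀ {a b} → a ∈ X ⊎ a ≡ w → b ∈ X ⊎ b ≡ w → ¬ Adj K a b
      independent (inj₁ a∈X) (inj₁ b∈X) = X-independent _ _ a∈X b∈X
      independent (inj₁ a∈X) (inj₂ refl) = w≁X _ a∈X ∘ Adj-sym
      independent (inj₂ refl) (inj₁ b∈X) = w≁X _ b∈X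
      independent (inj₂ refl) (inj₂ refl) = Graph.irrefl K w
      complete′ : ∀ {a b} → a ∈ X ⊎ a ≡ w → b ∈ Y → Adj K a b
      complete′ (inj₁ a∈X) b∈Y = complete _ _ a∈X b∈Y
      complete′ (inj₂ refl) b∈Y = w~Y _ b∈Y

  bipartition⇒biclique : ∀ {S} → Bipartition S → (∀ T → S ⊆ T → Bipartition T → T ⊆ S) → IsBiclique K S
  bipartition⇒biclique B maximal =
    fromBipartition B , λ T S⊆T T-cb → ⊆-antisym (maximal T S⊆T (toBipartition T-cb)) S⊆T

  has-neighbour : Connected K → ∀ {a b} → a ≢ b → ∃ (Adj K a)
  has-neighbour connected {a} {b} a≢b with connected a b
  ... | here = contradiction refl a≢b
  ... | step a~c _ = _ , a~c

  commonNeighbours : Subset n → Subset n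
  commonNeighbours N = select (λ z → all? (λ y → y ∈? N →-dec Adj? z y))

  ∈-commonNeighbours : ∀ {N z} → z ∈ commonNeighbours N ⇔ (∀ y → y ∈ N → Adj K z y)
  ∈-commonNeighbours = ∈-select _

  bicliqueWithSide : Subset n → Subset n
  bicliqueWithSide N = commonNeighbours N ∪ N

  module _ (triangle-free : TriangleFree K) {s : Fin n} {N : Subset n}
           (N≐N[s] : ∀ z → z ∈ N ⇔ Adj K s z) {y₀ : Fin n} (y₀∈N : y₀ ∈ N) where

    private
      C : Subset n
      C = commonNeighbours N

      s∈C : s ∈ C
      s∈C = from ∈-commonNeighbours (λ y → to (N≐N[s] y))

    bicliqueWithSide-bipartition : Bipartition (bicliqueWithSide N)
    bicliqueWithSide-bipartition = record
      { X = C ; Y = N ; X-nonempty = s , s∈C ; Y-nonempty = y₀ , y₀∈N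
      ; ∈-parts = λ _ → mk⇔ (x∈p∪q⁻ C N) x∈p∪q⁺
      ; X∩Y-empty = λ z z∈C z∈N → Graph.irrefl K z (to ∈-commonNeighbours z∈C z z∈N)
      ; X-independent = λ a b a∈C b∈C ab →
          triangle-free a b y₀ (ab , to ∈-commonNeighbours b∈C y₀ y₀∈N , to ∈-commonNeighbours a∈C y₀ y₀∈N)
      ; Y-independent = λ a b a∈N b∈N ab → triangle-free s a b (to (N≐N[s] a) a∈N , ab , to (N≐N[s] b) b∈N)
      ; complete = λ a b a∈C → to ∈-commonNeighbours a∈C b
      }

    private
      contained : ∀ {T} → bicliqueWithSide N ⊆ T → (B : Bipartition T) → s ∈ Bipartition.X B
        → T ⊆ bicliqueWithSide N
      contained {T} N⊆T B s∈X {t} t∈T = x∈p∪q⁺ (Sum.map in-C in-N (to (∈-parts t) t∈T))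
        where
          open Bipartition B
          N⊆Y : ∀ {y} → y ∈ N → y ∈ Y
          N⊆Y {y} y∈N with to (∈-parts y) (N⊆T (x∈p∪q⁺ (inj₂ y∈N)))
          ... | inj₁ y∈X = ⊥-elim (X-independent s y s∈X y∈X (to (N≐N[s] y) y∈N))
          ... | inj₂ y∈Y = y∈Y
          in-C : t ∈ X → t ∈ C
          in-C t∈X = from ∈-commonNeighbours λ y y∈N → complete t y t∈X (N⊆Y y∈N)
          in-N : t ∈ Y → t ∈ N
          in-N t∈Y = from (N≐N[s] t) (complete s t s∈X t∈Y)

    bicliqueWithSide-isBiclique : IsBiclique K (bicliqueWithSide N)
    bicliqueWithSide-isBiclique = bipartition⇒biclique bicliqueWithSide-bipartition maximal
      where
        maximal : ∀ T → bicliqueWithSide N ⊆ T → Bipartition T → T ⊆ bicliqueWithSide N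
        maximal T N⊆T B with to (Bipartition.∈-parts B s) (N⊆T (x∈p∪q⁺ (inj₁ s∈C)))
        ... | inj₁ s∈X = contained N⊆T B s∈X
        ... | inj₂ s∈Y = contained N⊆T (swap B) s∈Y

    ∈-side⇔nonadjacent : ∀ {y z} → y ∈ N → z ∈ bicliqueWithSide N → z ∈ N ⇔ (¬ Adj K y z)
    ∈-side⇔nonadjacent {y} {z} y∈N z∈B = mk⇔
      (λ z∈N y~z → triangle-free s y z (to (N≐N[s] y) y∈N , y~z , to (N≐N[s] z) z∈N))
      (in-N (x∈p∪q⁻ C N z∈B))
      where
        in-N : z ∈ C ⊎ z ∈ N → ¬ Adj K y z → z ∈ N
        in-N (inj₁ z∈C) y≁z = ⊥-elim (y≁z (Adj-sym (to ∈-commonNeighbours z∈C y y∈N)))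
        in-N (inj₂ z∈N) _ = z∈N

  bipartition-dominates-edges : ∀ {T} → Bipartition T → ∀ {w a b} → w ∈ T → a ∈ T → b ∈ T → Adj K a b
    → Adj K w a ⊎ Adj K w b
  bipartition-dominates-edges B {w} {a} {b} w∈T a∈T b∈T ab =
    dominate (edge-crosses B a∈T b∈T ab) (to (∈-parts w) w∈T)
    where
      open Bipartition B
      dominate : (a ∈ X × b ∈ Y) ⊎ (a ∈ Y × b ∈ X) → w ∈ X ⊎ w ∈ Y → Adj K w a ⊎ Adj K w b
      dominate (inj₁ (a∈X , b∈Y)) (inj₁ w∈X) = inj₂ (complete w b w∈X b∈Y)
      dominate (inj₁ (a∈X , b∈Y)) (inj₂ w∈Y) = inj₁ (Adj-sym (complete a w a∈X w∈Y))
      dominate (inj₂ (a∈Y , b∈X)) (inj₁ w∈X) = inj₁ (complete w a w∈X a∈Y)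
      dominate (inj₂ (a∈Y , b∈X)) (inj₂ w∈Y) = inj₂ (Adj-sym (complete b w b∈X w∈Y))

  twin-set-neighbours : ∀ {F} → IsFalseTwinSet K F → ∀ {a b} → a ∈ F → b ∈ F → ∀ x → Adj K a x ⇔ Adj K b x
  twin-set-neighbours (_ , pairwise , _) {a} {b} a∈F b∈F with a ≟ᶠ b
  ... | yes refl = λ x → ⇔-id (Adj K a x)
  ... | no a≢b = proj₂ (pairwise a b a∈F b∈F a≢b)

  false-twin-sets-equal : ∀ {F F'} → IsFalseTwinSet K F → IsFalseTwinSet K F' → ∀ {a b} → a ∈ F → b ∈ F'
    → (∀ x → Adj K a x ⇔ Adj K b x) → F ≡ F'
  false-twin-sets-equal {F} {F'} F-twins F'-twins {a} {b} a∈F b∈F' a≈b =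
    trans (sym (proj₂ (proj₂ F-twins) (F ∪ F') (p⊆p∪q F') union-twins))
          (proj₂ (proj₂ F'-twins) (F ∪ F') (q⊆p∪q F F') union-twins)
    where
      like-a : ∀ {c} → c ∈ F ∪ F' → ∀ x → Adj K c x ⇔ Adj K a x
      like-a c∈ x with x∈p∪q⁻ F F' c∈
      ... | inj₁ c∈F = twin-set-neighbours F-twins c∈F a∈F x
      ... | inj₂ c∈F' = ⇔-sym (a≈b x) ⇔-∘ twin-set-neighbours F'-twins c∈F' b∈F' x
      union-twins : PairwiseFalseTwins K (F ∪ F')
      union-twins c d c∈ d∈ c≢d = c≢d , λ x → ⇔-sym (like-a d∈ x) ⇔-∘ like-a c∈ x

-- Deleting a vertex

module _ {m : ℕ} (v : Fin (suc m)) where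

  data VertexView : Fin (suc m) → Set where
    deleted : VertexView v
    kept    : ∀ j → VertexView (punchIn v j)

  view : ∀ z → VertexView z
  view z with v ≟ᶠ z
  ... | yes refl = deleted
  ... | no v≢z = subst VertexView (punchIn-punchOut v≢z) (kept (punchOut v≢z))

  v∈insertAt⇔ : ∀ {W : Subset m} {c} → v ∈ insertAt W v c ⇔ c ≡ true
  v∈insertAt⇔ {W} {c} = mk⇔
    (λ v∈ → trans (sym (insertAt-lookup W v c)) ([]=⇒lookup v∈))
    (λ c≡true → lookup⇒[]= v _ (trans (insertAt-lookup W v c) c≡true))

  punchIn∈insertAt⇔ : ∀ {W : Subset m} {c j} → punchIn v j ∈ insertAt W v c ⇔ j ∈ W
  punchIn∈insertAt⇔ {W} {c} {j} = mk⇔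
    (λ j∈ → lookup⇒[]= j W (trans (sym (insertAt-punchIn W v c j)) ([]=⇒lookup j∈)))
    (λ j∈ → lookup⇒[]= (punchIn v j) _ (trans (insertAt-punchIn W v c j) ([]=⇒lookup j∈)))

  embed : Subset m → Subset (suc m)
  embed S = insertAt S v false

  ∈-embed⁻ : ∀ {S z} → z ∈ embed S → ∃[ j ] z ≡ punchIn v j × j ∈ S
  ∈-embed⁻ {z = z} z∈ with view z
  ... | deleted = contradiction (to v∈insertAt⇔ z∈) λ ()
  ... | kept j = j , refl , to punchIn∈insertAt⇔ z∈

  restrict : Subset (suc m) → Subset m
  restrict T = select (λ j → punchIn v j ∈? T)

  ∈-restrict : ∀ {T j} → j ∈ restrict T ⇔ punchIn v j ∈ T
  ∈-restrict = ∈-select _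

  restrict-insertAt : ∀ S c → restrict (insertAt S v c) ≡ S
  restrict-insertAt S c =
    ⊆-antisym (to punchIn∈insertAt⇔ ∘ to ∈-restrict) (from ∈-restrict ∘ from punchIn∈insertAt⇔)

  embed-∪-⁅v⁆ : ∀ {S} z → z ∈ embed S ∪ ⁅ v ⁆ ⇔ z ∈ insertAt S v true
  embed-∪-⁅v⁆ z with view z
  ... | deleted = mk⇔ (λ _ → from v∈insertAt⇔ refl) (λ _ → from ∈-∪⁅⁆ (inj₂ refl))
  ... | kept j = mk⇔ (kept-∈ ∘ to ∈-∪⁅⁆) (from ∈-∪⁅⁆ ∘ inj₁ ∘ from punchIn∈insertAt⇔ ∘ to punchIn∈insertAt⇔)
    where
      kept-∈ : punchIn v j ∈ embed _ ⊎ punchIn v j ≡ v → punchIn v j ∈ insertAt _ v true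
      kept-∈ (inj₁ j∈) = from punchIn∈insertAt⇔ (to punchIn∈insertAt⇔ j∈)
      kept-∈ (inj₂ j≡v) = contradiction j≡v (punchInᵢ≢i v j)

  module _ (G : Graph (suc m)) where

    private
      H : Graph m
      H = deleteVertex G v

    embed-bipartition : ∀ {S} → Bipartition H S → Bipartition G (embed S)
    embed-bipartition {S} B = record
      { X = embed X ; Y = embed Y
      ; X-nonempty = Data.Product.map (punchIn v) (from punchIn∈insertAt⇔) X-nonempty
      ; Y-nonempty = Data.Product.map (punchIn v) (from punchIn∈insertAt⇔) Y-nonempty
      ; ∈-parts = λ z → mk⇔ parts⁺ parts⁻
      ; X∩Y-empty = λ z z∈X z∈Y → case ∈-embed⁻ z∈X of λ
          { (j , refl , j∈X) → X∩Y-empty j j∈X (to punchIn∈insertAt⇔ z∈Y) }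
      ; X-independent = independent X-independent
      ; Y-independent = independent Y-independent
      ; complete = λ a b a∈X b∈Y → case ∈-embed⁻ a∈X , ∈-embed⁻ b∈Y of λ
          { ((i , refl , i∈X) , (j , refl , j∈Y)) → complete i j i∈X j∈Y }
      }
      where
        open Bipartition B
        parts⁺ : ∀ {z} → z ∈ embed S → z ∈ embed X ⊎ z ∈ embed Y
        parts⁺ z∈ with ∈-embed⁻ z∈
        ... | j , refl , j∈S = Sum.map (from punchIn∈insertAt⇔) (from punchIn∈insertAt⇔) (to (∈-parts j) j∈S)
        parts⁻ : ∀ {z} → z ∈ embed X ⊎ z ∈ embed Y → z ∈ embed S
        parts⁻ (inj₁ z∈X) with ∈-embed⁻ z∈X
        ... | j , refl , j∈X = from punchIn∈insertAt⇔ (from (∈-parts j) (inj₁ j∈X))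
        parts⁻ (inj₂ z∈Y) with ∈-embed⁻ z∈Y
        ... | j , refl , j∈Y = from punchIn∈insertAt⇔ (from (∈-parts j) (inj₂ j∈Y))
        independent : ∀ {P} → (∀ a b → a ∈ P → b ∈ P → ¬ Adj H a b)
          → ∀ a b → a ∈ embed P → b ∈ embed P → ¬ Adj G a b
        independent P-ind a b a∈ b∈ with ∈-embed⁻ a∈ | ∈-embed⁻ b∈
        ... | i , refl , i∈P | j , refl , j∈P = P-ind i j i∈P j∈P

    restrict-bipartition : ∀ {T} (B : Bipartition G T) → let open Bipartition B in
      ∀ {a b} → punchIn v a ∈ X → punchIn v b ∈ Y → Bipartition H (restrict T)
    restrict-bipartition B {a} {b} a∈X b∈Y = record
      { X = restrict X ; Y = restrict Y
      ; X-nonempty = a , from ∈-restrict a∈X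
      ; Y-nonempty = b , from ∈-restrict b∈Y
      ; ∈-parts = λ z → mk⇔ (Sum.map (from ∈-restrict) (from ∈-restrict) ∘ to (∈-parts _) ∘ to ∈-restrict)
                            (from ∈-restrict ∘ from (∈-parts _) ∘ Sum.map (to ∈-restrict) (to ∈-restrict))
      ; X∩Y-empty = λ z z∈X z∈Y → X∩Y-empty _ (to ∈-restrict z∈X) (to ∈-restrict z∈Y)
      ; X-independent = λ c d c∈X d∈X → X-independent _ _ (to ∈-restrict c∈X) (to ∈-restrict d∈X)
      ; Y-independent = λ c d c∈Y d∈Y → Y-independent _ _ (to ∈-restrict c∈Y) (to ∈-restrict d∈Y)
      ; complete = λ c d c∈X d∈Y → complete _ _ (to ∈-restrict c∈X) (to ∈-restrict d∈Y)
      }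
      where open Bipartition B

    restrict-maximal : ∀ {S T} → IsBiclique H S → (∀ {x} → x ∈ S → punchIn v x ∈ T) → Bipartition G T
      → restrict T ≡ S
    restrict-maximal {S} {T} (S-cb , S-maximal) S⊆T B =
      S-maximal (restrict T) (from ∈-restrict ∘ S⊆T) (fromBipartition H restricted)
      where
        open Bipartition (toBipartition H S-cb)
        restricted : Bipartition H (restrict T)
        restricted with edge-crosses G B (S⊆T (X⊆S x₀∈X)) (S⊆T (Y⊆S y₀∈Y)) (complete _ _ x₀∈X y₀∈Y)
        ... | inj₁ (x₀∈X' , y₀∈Y') = restrict-bipartition B x₀∈X' y₀∈Y'
        ... | inj₂ (x₀∈Y' , y₀∈X') = restrict-bipartition B y₀∈X' x₀∈Y'

-- Bicliques of G from bicliques and false-twin sets of G − v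

module _ {m : ℕ} (G : Graph (suc m)) (v : Fin (suc m)) where

  private
    H : Graph m
    H = deleteVertex G v

  -- For triangle-free G, Covered S holds exactly when S ∪ {v} is still complete bipartite.
  Covered : Subset m → Set
  Covered S = ∀ x y → x ∈ S → y ∈ S → Adj H x y → Adj G v (punchIn v x) ⊎ Adj G v (punchIn v y)

  covered? : Decidable Covered
  covered? S = all? λ x → all? λ y →
    x ∈? S →-dec y ∈? S →-dec Adj? H x y →-dec (Adj? G v (punchIn v x) ⊎-dec Adj? G v (punchIn v y))

  lift : Subset m → Subset (suc m)
  lift S = insertAt S v (isYes (covered? S))

  restrict-lift : ∀ S → restrict v (lift S) ≡ S
  restrict-lift S = restrict-insertAt v S _

  lift-injective : ∀ {S S'} → lift S ≡ lift S' → S ≡ S'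
  lift-injective {S} {S'} eq = trans (sym (restrict-lift S)) (trans (cong (restrict v) eq) (restrict-lift S'))

  module _ (triangle-free : TriangleFree G) where

    private
      dominated-side : ∀ {S} → Covered S → (B : Bipartition H S) → let open Bipartition B in
        ∀ {u} → u ∈ X → Adj G v (punchIn v u) → ∀ x → x ∈ X → Adj G v (punchIn v x)
      dominated-side S-covered B {u} u∈X v~u x x∈X =
        Sum.[ (λ v~x → v~x) , (λ v~y₀ → ⊥-elim (triangle-free v _ _ (v~u , complete u y₀ u∈X y₀∈Y , v~y₀))) ]
          (S-covered x y₀ (X⊆S x∈X) (Y⊆S y₀∈Y) (complete x y₀ x∈X y₀∈Y))
        where open Bipartition B

      covered-side : ∀ {S} → Covered S → (B : Bipartition H S) → let open Bipartition B in
        (∀ x → x ∈ X → Adj G v (punchIn v x)) ⊎ (∀ y → y ∈ Y → Adj G v (punchIn v y))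
      covered-side S-covered B =
        Sum.map (dominated-side S-covered B x₀∈X) (dominated-side S-covered (swap H B) y₀∈Y)
          (S-covered x₀ y₀ (X⊆S x₀∈X) (Y⊆S y₀∈Y) (complete x₀ y₀ x₀∈X y₀∈Y))
        where open Bipartition B

      attach : ∀ {S} (B : Bipartition H S) → (∀ x → x ∈ Bipartition.X B → Adj G v (punchIn v x))
        → Bipartition G (embed v S ∪ ⁅ v ⁆)
      attach B v~X = Bipartition-∪-⁅⁆ G (swap G (embed-bipartition v G B)) v~embedX v≁embedY
        where
          open Bipartition B
          v~embedX : ∀ z → z ∈ embed v X → Adj G v z
          v~embedX z z∈ with ∈-embed⁻ v z∈
          ... | x , refl , x∈X = v~X x x∈X
          v≁embedY : ∀ z → z ∈ embed v Y → ¬ Adj G v z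
          v≁embedY z z∈ v~z with ∈-embed⁻ v z∈
          ... | y , refl , y∈Y = triangle-free v _ _
                (v~X x₀ x₀∈X , complete x₀ y x₀∈X y∈Y , v~z)

    lift-bipartition : ∀ {S} → Bipartition H S → Bipartition G (lift S)
    lift-bipartition {S} B = by-cases (covered? S)
      where
        by-cases : (d : Dec (Covered S)) → Bipartition G (insertAt S v (isYes d))
        by-cases (no _) = embed-bipartition v G B
        by-cases (yes S-covered) = Bipartition-resp G (embed-∪-⁅v⁆ v)
          (Sum.[ attach B , attach (swap H B) ] (covered-side S-covered B))

    lift-maximal : ∀ {S} → IsBiclique H S → ∀ T → lift S ⊆ T → Bipartition G T → T ⊆ lift S
    lift-maximal {S} S-biclique T lift⊆T B = contained (lift⊆T ∘ from (punchIn∈insertAt⇔ v))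
      where
        contained : (∀ {x} → x ∈ S → punchIn v x ∈ T) → T ⊆ lift S
        contained S⊆T {t} t∈T with view v t
        ... | deleted = from (v∈insertAt⇔ v) (from (isYes≡true⇔ (covered? S))
                          λ x y x∈S y∈S → bipartition-dominates-edges G B t∈T (S⊆T x∈S) (S⊆T y∈S))
        ... | kept j = from (punchIn∈insertAt⇔ v)
                          (subst (j ∈_) (restrict-maximal v G S-biclique S⊆T B) (from (∈-restrict v) t∈T))

    lift-isBiclique : ∀ {S} → IsBiclique H S → IsBiclique G (lift S)
    lift-isBiclique S-biclique =
      bipartition⇒biclique G (lift-bipartition (toBipartition H (proj₁ S-biclique))) (lift-maximal S-biclique)

  falseTwins-punchIn : ∀ {u w} → FalseTwins H u w → (Adj G (punchIn v u) v ⇔ Adj G (punchIn v w) v)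
    → FalseTwins G (punchIn v u) (punchIn v w)
  falseTwins-punchIn {u} {w} (u≢w , u≈w) u≈w-at-v = u≢w ∘ punchIn-injective v u w , same-neighbours
    where
      same-neighbours : ∀ x → Adj G (punchIn v u) x ⇔ Adj G (punchIn v w) x
      same-neighbours x with view v x
      ... | deleted = u≈w-at-v
      ... | kept j = u≈w j

  record Separation (F : Subset m) : Set where
    field
      s₁ s₂ : Fin m
      s₁∈F : s₁ ∈ F
      s₂∈F : s₂ ∈ F
      s₁~v : Adj G (punchIn v s₁) v
      s₂≁v : ¬ Adj G (punchIn v s₂) v

  separation : NoFalseTwins G → ∀ {F} → IsFalseTwinSet H F → Separation F
  separation no-twins ((u , w , u∈F , w∈F , u≢w) , pairwise , _)
    with Adj? G (punchIn v u) v | Adj? G (punchIn v w) v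
  ... | yes u~v | no w≁v = record { s₁ = u ; s₂ = w ; s₁∈F = u∈F ; s₂∈F = w∈F ; s₁~v = u~v ; s₂≁v = w≁v }
  ... | no u≁v | yes w~v = record { s₁ = w ; s₂ = u ; s₁∈F = w∈F ; s₂∈F = u∈F ; s₁~v = w~v ; s₂≁v = u≁v }
  ... | yes u~v | yes w~v =
    ⊥-elim (no-twins _ _ (falseTwins-punchIn (pairwise u w u∈F w∈F u≢w) (mk⇔ (λ _ → w~v) (λ _ → u~v))))
  ... | no u≁v | no w≁v =
    ⊥-elim (no-twins _ _ (falseTwins-punchIn (pairwise u w u∈F w∈F u≢w) (mk⇔ (⊥-elim ∘ u≁v) (⊥-elim ∘ w≁v))))

  AdjacentTo : Subset m → Fin (suc m) → Set
  AdjacentTo F z = ∃[ s ] s ∈ F × Adj G (punchIn v s) z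

  adjacentTo? : ∀ F → Decidable (AdjacentTo F)
  adjacentTo? F z = any? (λ s → s ∈? F ×-dec Adj? G (punchIn v s) z)

  -- This is N_G(s) for any s ∈ F adjacent to v, but defined from F alone so that star is a function of F.
  neighbourhood : Subset m → Subset (suc m)
  neighbourhood F = select (adjacentTo? F)

  ∈-neighbourhood : ∀ {F z} → z ∈ neighbourhood F ⇔ AdjacentTo F z
  ∈-neighbourhood {F} = ∈-select (adjacentTo? F)

  ∈-neighbourhood⇔Adj : ∀ {F} → IsFalseTwinSet H F → ∀ {s} → s ∈ F → Adj G (punchIn v s) v
    → ∀ z → z ∈ neighbourhood F ⇔ Adj G (punchIn v s) z
  ∈-neighbourhood⇔Adj {F} F-twins {s} s∈F s~v z =
    mk⇔ (adjacent ∘ to ∈-neighbourhood) (λ s~z → from ∈-neighbourhood (s , s∈F , s~z))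
    where
      adjacent : AdjacentTo F z → Adj G (punchIn v s) z
      adjacent (s' , s'∈F , s'~z) with view v z
      ... | deleted = s~v
      ... | kept j = to (twin-set-neighbours H F-twins s'∈F s∈F j) s'~z

  star : Subset m → Subset (suc m)
  star F = bicliqueWithSide G (neighbourhood F)

  module _ (triangle-free : TriangleFree G) (no-twins : NoFalseTwins G) where

    private
      module StarOf {F} (F-twins : IsFalseTwinSet H F) where
        open Separation (separation no-twins F-twins) public

        N≐N[s₁] : ∀ z → z ∈ neighbourhood F ⇔ Adj G (punchIn v s₁) z
        N≐N[s₁] = ∈-neighbourhood⇔Adj F-twins s₁∈F s₁~v

        v∈N : v ∈ neighbourhood F
        v∈N = from (N≐N[s₁] v) s₁~v

        ∈N⇔¬v~ : ∀ {z} → z ∈ star F → z ∈ neighbourhood F ⇔ (¬ Adj G v z)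
        ∈N⇔¬v~ = ∈-side⇔nonadjacent G triangle-free N≐N[s₁] v∈N v∈N

        s₁≈s₂ : ∀ x → Adj H s₁ x ⇔ Adj H s₂ x
        s₁≈s₂ = twin-set-neighbours H F-twins s₁∈F s₂∈F

        s₂≢s₁ : punchIn v s₂ ≢ punchIn v s₁
        s₂≢s₁ s₂≡s₁ = s₂≁v (subst (λ z → Adj G z v) (sym s₂≡s₁) s₁~v)

    star-isBiclique : ∀ {F} → IsFalseTwinSet H F → IsBiclique G (star F)
    star-isBiclique F-twins = bicliqueWithSide-isBiclique G triangle-free N≐N[s₁] v∈N
      where open StarOf F-twins

    private
      neighbourhood-⊆ : ∀ {F F'} → IsFalseTwinSet H F → IsFalseTwinSet H F' → star F ≡ star F'
        → neighbourhood F ⊆ neighbourhood F'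
      neighbourhood-⊆ {F} F-twins F'-twins eq {z} z∈N =
        from (F'.∈N⇔¬v~ (subst (z ∈_) eq z∈star)) (to (F.∈N⇔¬v~ z∈star) z∈N)
        where
          module F = StarOf F-twins
          module F' = StarOf F'-twins
          z∈star : z ∈ star F
          z∈star = x∈p∪q⁺ (inj₂ z∈N)

    star-injective : ∀ {F F'} → IsFalseTwinSet H F → IsFalseTwinSet H F' → star F ≡ star F' → F ≡ F'
    star-injective {F} {F'} F-twins F'-twins eq =
      false-twin-sets-equal H F-twins F'-twins F.s₁∈F F'.s₁∈F λ x →
        F'.N≐N[s₁] (punchIn v x) ⇔-∘ (N≐N' ⇔-∘ ⇔-sym (F.N≐N[s₁] (punchIn v x)))
      where
        module F = StarOf F-twins
        module F' = StarOf F'-twins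
        N≐N' : ∀ {z} → z ∈ neighbourhood F ⇔ z ∈ neighbourhood F'
        N≐N' = mk⇔ (neighbourhood-⊆ F-twins F'-twins eq) (neighbourhood-⊆ F'-twins F-twins (sym eq))

    module _ (connected : Connected G) where

      restrict-star-not-biclique : ∀ {F} → IsFalseTwinSet H F → ¬ IsBiclique H (restrict v (star F))
      restrict-star-not-biclique {F} F-twins (_ , R-maximal) =
        s₂∉R (subst (s₂ ∈_) R∪s₂≡R (from ∈-∪⁅⁆ (inj₂ refl)))
        where
          open StarOf F-twins
          B : Bipartition G (star F)
          B = bicliqueWithSide-bipartition G triangle-free N≐N[s₁] v∈N
          open Bipartition B

          s₂-neighbour : ∃ (Adj H s₂)
          s₂-neighbour with has-neighbour G connected s₂≢s₁
          ... | z , s₂~z with view v z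
          ...   | deleted = contradiction s₂~z s₂≁v
          ...   | kept b = b , s₂~z

          s₂~Y : ∀ y → y ∈ restrict v Y → Adj H s₂ y
          s₂~Y y y∈Y = to (s₁≈s₂ y) (to (N≐N[s₁] _) (to (∈-restrict v) y∈Y))

          s₂≁X : ∀ x → x ∈ restrict v X → ¬ Adj H s₂ x
          s₂≁X x x∈X s₂~x = X∩Y-empty _ (to (∈-restrict v) x∈X) (from (N≐N[s₁] _) (from (s₁≈s₂ x) s₂~x))

          R∪s₂ : Bipartition H (restrict v (star F) ∪ ⁅ s₂ ⁆)
          R∪s₂ = Bipartition-∪-⁅⁆ H (restrict-bipartition v G B x₀∈X b∈Y) s₂~Y s₂≁X
            where
              b∈Y : punchIn v (proj₁ s₂-neighbour) ∈ Y
              b∈Y = from (N≐N[s₁] _) (from (s₁≈s₂ _) (proj₂ s₂-neighbour))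

          R∪s₂≡R : restrict v (star F) ∪ ⁅ s₂ ⁆ ≡ restrict v (star F)
          R∪s₂≡R = R-maximal _ (p⊆p∪q ⁅ s₂ ⁆) (fromBipartition H R∪s₂)

          s₂∉R : s₂ ∉ restrict v (star F)
          s₂∉R s₂∈R = Graph.irrefl H s₂ (to (s₁≈s₂ s₂) (to (N≐N[s₁] _)
            (from (∈N⇔¬v~ (to (∈-restrict v) s₂∈R)) (s₂≁v ∘ Adj-sym G))))

      lift≢star : ∀ {S F} → IsBiclique H S → IsFalseTwinSet H F → lift S ≢ star F
      lift≢star {S} S-biclique F-twins lift≡star = restrict-star-not-biclique F-twins
        (subst (IsBiclique H) (trans (sym (restrict-lift S)) (cong (restrict v) lift≡star)) S-biclique)

corollary4p4 : {m : ℕ} (G : Graph (suc m)) (v : Fin (suc m)) (k : ℕ)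
    → Connected G → TriangleFree G → NoFalseTwins G
    → (FT : List (Subset m)) → Enumerates (IsFalseTwinSet (deleteVertex G v)) FT
    → length FT ≡ k
    → (BG : List (Subset (suc m))) → Enumerates (IsBiclique G) BG
    → (BGv : List (Subset m)) → Enumerates (IsBiclique (deleteVertex G v)) BGv
    → length BGv + k ≤ length BG
corollary4p4 G v _ connected triangle-free no-twins FT FT-enum refl BG BG-enum BGv BGv-enum =
  enumeration-count BGv-enum FT-enum BG-enum (lift G v) (star G v)
    (lift-isBiclique G v triangle-free)
    (star-isBiclique G v triangle-free no-twins)
    (λ _ _ → lift-injective G v)
    (star-injective G v triangle-free no-twins)
    (lift≢star G v triangle-free no-twins connected)
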